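{- For every $k\ge 1$, with $G^k$, $p^k_b$, $p^k_e$ as defined in the context, the reconfiguration distance between $p^k_b$ and $p^k_e$ in the reconfiguration graph of shortest $(s,t)$-paths of $G^k$ is at most $11(2^k-1)$.
   Context: Reconfiguration graph of shortest $(s,t)$-paths of a graph: its vertices are the shortest $(s,t)$-paths (viewed as vertex sequences), and two of them are adjacent iff, as sequences, they differ in exactly one position. The reconfiguration distance is the distance in this graph. The undirected graph $G^1$ has vertices $x^1_1,\dots,x^1_7$, $y^1_1,\dots,y^1_6$, $s$, $t$ and edges $x^1_iy^1_i$, $x^1_{i+1}y^1_i$, $y^1_it$ for $1\le i\le 6$, and $sx^1_i$ for $1\le i\le 7$. For $k\ge 2$, $G^k$ has vertex set $V(G^{k-1})\cup\{x^k_1,\dots,x^k_7,y^k_1,\dots,y^k_6\}$ and edge set consisting of: $x^k_iy^k_i$ and $x^k_{i+1}y^k_i$ for $1\le i\le 6$; $y^k_ix^{k-1}_j$ for $i\in\{1,3,5\}$ and $1\le j\le 7$; $y^k_2x^{k-1}_1$, $y^k_4x^{k-1}_7$, $y^k_6x^{k-1}_1$; all edges of $G^{k-1}$ not incident to $s$; and $sx^k_i$ for $1\le i\le 7$. Let $p^k_b=s,x^k_1,y^k_1,x^{k-1}_1,y^{k-1}_1,\dots,x^1_1,y^1_1,t$ and $p^k_e=s,x^k_7,y^k_6,x^{k-1}_1,y^{k-1}_1,\dots,x^1_1,y^1_1,t$. -}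

module Defs where

open import Data.Nat using (ℕ; zero; suc; pred; _≤_)
open import Data.List using (List; []; _∷_; length; head; last)
open import Data.Maybe using (Maybe; just)
open import Data.Unit using (⊤)
open import Data.Sum using (_⊎_)
open import Data.Product using (_×_)
open import Relation.Binary.PropositionalEquality using (_≡_; _≢_)

-- Vertices: s, t, x j i  (= x^j_i, 1 ≤ i ≤ 7), y j i (= y^j_i, 1 ≤ i ≤ 6).
-- Indices are 1-based exactly as in the paper; which of them belong
-- to G^k is enforced by the edge relation (1 ≤ j ≤ k).
data V : Set where
  s t : V
  x y : ℕ → ℕ → V

data Edge (k : ℕ) : V → V → Set where
  xy-same : ∀ {j i} → 1 ≤ j → j ≤ k → 1 ≤ i → i ≤ 6 → Edge k (x j i) (y j i)
  xy-next : ∀ {j i} → 1 ≤ j → j ≤ k → 1 ≤ i → i ≤ 6 → Edge k (x j (suc i)) (y j i)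
  yt : ∀ {i} → 1 ≤ k → 1 ≤ i → i ≤ 6 → Edge k (y 1 i) t
  sx : ∀ {i} → 1 ≤ k → 1 ≤ i → i ≤ 7 → Edge k s (x k i)
  yx-odd : ∀ {j i i'} → 1 ≤ j → suc j ≤ k → (i ≡ 1 ⊎ i ≡ 3 ⊎ i ≡ 5) →
           1 ≤ i' → i' ≤ 7 → Edge k (y (suc j) i) (x j i')
  yx-2 : ∀ {j} → 1 ≤ j → suc j ≤ k → Edge k (y (suc j) 2) (x j 1)
  yx-4 : ∀ {j} → 1 ≤ j → suc j ≤ k → Edge k (y (suc j) 4) (x j 7)
  yx-6 : ∀ {j} → 1 ≤ j → suc j ≤ k → Edge k (y (suc j) 6) (x j 1)

Adj : ℕ → V → V → Set
Adj k u v = Edge k u v ⊎ Edge k v u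

Chain : ℕ → List V → Set
Chain k [] = ⊤
Chain k (u ∷ []) = ⊤
Chain k (u ∷ v ∷ rest) = Adj k u v × Chain k (v ∷ rest)

STWalk : ℕ → List V → Set
STWalk k p = Chain k p × head p ≡ just s × last p ≡ just t

-- a shortest (s,t)-path: an (s,t)-walk no longer than any other (s,t)-walk
-- (such a walk automatically has distinct vertices)
Shortest : ℕ → List V → Set
Shortest k p = STWalk k p × (∀ q → STWalk k q → length p ≤ length q)

data DiffOne : List V → List V → Set where
  here  : ∀ {a b xs} → a ≢ b → DiffOne (a ∷ xs) (b ∷ xs)
  there : ∀ {a xs ys} → DiffOne xs ys → DiffOne (a ∷ xs) (a ∷ ys)

data Reach (k : ℕ) : ℕ → List V → List V → Set where
  done : ∀ {p} → Shortest k p → Reach k 0 p p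
  step : ∀ {n p q r} → Shortest k p → DiffOne p q → Reach k n q r →
         Reach k (suc n) p r

down : ℕ → List V
down zero = t ∷ []
down (suc j) = x (suc j) 1 ∷ y (suc j) 1 ∷ down j

pb : ℕ → List V
pb k = s ∷ down k

pe : ℕ → List V
pe k = s ∷ x k 7 ∷ y k 6 ∷ down (pred k)

-- Every edge of G^k goes down exactly one level in the order s, x^k, y^k, x^(k-1), …, y^1, t,
-- so the shortest (s,t)-paths are the sequences s, x^k_a, y^k_b, …, x^1_a', y^1_b', t.
-- Reconfigure the part of a path below level j+1 recursively while its top pair walks along
-- the zigzag x_1 y_1 x_2 y_2 … y_6 x_7 of level j+1. Since y_3 and y_5 see all of level j,
-- beneath them the lower part can be turned from the p_b shape (needed beneath y_2 and y_6,
-- which only see x^j_1) into the p_e shape (needed beneath y_4, which only sees x^j_7) and back.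
-- This costs T(j+1) = 11 + 2 T(j) steps, whence T(k) = 11 (2^k - 1).
module Submission where

open import Defs
open import Data.Nat using (ℕ; zero; suc; _+_; _*_; _^_; _∸_; _≤_; _≤ᵇ_; z≤n; s≤s)
open import Data.Nat.Properties using (≤-refl; ≤-trans; ≤-reflexive; n≤1+n; m≤n⇒m≤1+n; m≤n+m; ≤ᵇ⇒≤; m+n∸n≡m; *-distribˡ-∸)
open import Data.Nat.Tactic.RingSolver using (solve-∀)
open import Data.Bool using (T)
open import Data.List using (List; []; _∷_; _++_; length; last)
open import Data.Maybe using (just)
open import Data.Empty using (⊥)
open import Data.Unit using (tt)
open import Data.Sum using (_⊎_; inj₁; inj₂)
open import Data.Product using (_×_; _,_; ∃-syntax)
open import Relation.Binary.PropositionalEquality using (_≡_; refl; sym; cong; cong₂; module ≡-Reasoning)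

data Walk (P : List V → Set) : ℕ → List V → List V → Set where
  [_]    : ∀ {p} → P p → Walk P 0 p p
  _∷⟨_⟩_ : ∀ {n p q r} → P p → DiffOne p q → Walk P n q r → Walk P (suc n) p r

infixr 5 _∷⟨_⟩_

DiffOne-sym : ∀ {p q} → DiffOne p q → DiffOne q p
DiffOne-sym (here a≢b) = here (λ b≡a → a≢b (sym b≡a))
DiffOne-sym (there d) = there (DiffOne-sym d)

DiffOne-++ˡ : ∀ pre {p q} → DiffOne p q → DiffOne (pre ++ p) (pre ++ q)
DiffOne-++ˡ [] d = d
DiffOne-++ˡ (u ∷ pre) d = there (DiffOne-++ˡ pre d)

module _ {P : List V → Set} where

  source : ∀ {n p q} → Walk P n p q → P p
  source [ π ] = π
  source (π ∷⟨ _ ⟩ _) = π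

  target : ∀ {n p q} → Walk P n p q → P q
  target [ π ] = π
  target (_ ∷⟨ _ ⟩ w) = target w

  infixr 5 _++ʷ_

  _++ʷ_ : ∀ {n m p q r} → Walk P n p q → Walk P m q r → Walk P (n + m) p r
  [ _ ] ++ʷ w′ = w′
  (π ∷⟨ d ⟩ w) ++ʷ w′ = π ∷⟨ d ⟩ (w ++ʷ w′)

  snoc : ∀ {n p q r} → Walk P n p q → DiffOne q r → P r → Walk P (suc n) p r
  snoc [ π ] d ρ = π ∷⟨ d ⟩ [ ρ ]
  snoc (π ∷⟨ d′ ⟩ w) d ρ = π ∷⟨ d′ ⟩ snoc w d ρ

  reverse : ∀ {n p q} → Walk P n p q → Walk P n q p
  reverse [ π ] = [ π ]
  reverse (π ∷⟨ d ⟩ w) = snoc (reverse w) (DiffOne-sym d) π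

prepend : ∀ {P Q : List V → Set} pre → (∀ {l} → P l → Q (pre ++ l)) →
          ∀ {n p q} → Walk P n p q → Walk Q n (pre ++ p) (pre ++ q)
prepend pre f [ π ] = [ f π ]
prepend pre f (π ∷⟨ d ⟩ w) = f π ∷⟨ DiffOne-++ˡ pre d ⟩ prepend pre f w

Walk⇒Reach : ∀ {k n p q} → Walk (Shortest k) n p q → Reach k n p q
Walk⇒Reach [ π ] = done π
Walk⇒Reach (π ∷⟨ d ⟩ w) = step π d (Walk⇒Reach w)

double : ℕ → ℕ
double zero = 0
double (suc n) = suc (suc (double n))

level : ℕ → V → ℕ
level k s = suc (double k)
level k t = 0
level k (x j _) = double j
level k (y zero _) = 0            -- y^0 is not a vertex of G^k
level k (y (suc j) _) = suc (double j)

edge-level : ∀ {k u v} → Edge k u v → level k u ≡ suc (level k v)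
edge-level (xy-same (s≤s z≤n) _ _ _) = refl
edge-level (xy-next (s≤s z≤n) _ _ _) = refl
edge-level (yt _ _ _) = refl
edge-level (sx _ _ _) = refl
edge-level (yx-odd _ _ _ _ _) = refl
edge-level (yx-2 _ _) = refl
edge-level (yx-4 _ _) = refl
edge-level (yx-6 _ _) = refl

adj-level : ∀ {k u v} → Adj k u v → level k u ≤ suc (level k v)
adj-level (inj₁ uv) = ≤-reflexive (edge-level uv)
adj-level {k} {u} (inj₂ vu) = ≤-trans (m≤n+m (level k u) 2) (≤-reflexive (cong suc (sym (edge-level vu))))

level≤length : ∀ {k u l} → Chain k (u ∷ l) → last (u ∷ l) ≡ just t → level k u ≤ length l
level≤length {l = []} _ refl = z≤n
level≤length {l = v ∷ l} (uv , chain) ends = ≤-trans (adj-level uv) (s≤s (level≤length chain ends))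

STWalk-length : ∀ {k q} → STWalk k q → suc (suc (double k)) ≤ length q
STWalk-length {q = []} (_ , () , _)
STWalk-length {q = u ∷ l} (chain , refl , ends) = s≤s (level≤length chain ends)

x-index : ∀ {k j a v} → Adj k (x j a) v → 1 ≤ a × a ≤ 7
x-index (inj₁ (xy-same _ _ a≥1 a≤6)) = a≥1 , m≤n⇒m≤1+n a≤6
x-index (inj₁ (xy-next _ _ _ a≤6)) = s≤s z≤n , s≤s a≤6
x-index (inj₂ (sx _ a≥1 a≤7)) = a≥1 , a≤7
x-index (inj₂ (yx-odd _ _ _ a≥1 a≤7)) = a≥1 , a≤7
x-index (inj₂ (yx-2 _ _)) = s≤s z≤n , s≤s z≤n
x-index (inj₂ (yx-4 _ _)) = s≤s z≤n , ≤-refl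
x-index (inj₂ (yx-6 _ _)) = s≤s z≤n , s≤s z≤n

AdjHead : ℕ → V → List V → Set
AdjHead k v [] = ⊥
AdjHead k v (u ∷ _) = Adj k v u

data Tail (k : ℕ) : ℕ → List V → Set where
  tip  : Tail k 0 (t ∷ [])
  rung : ∀ {j a b l} → Adj k (x (suc j) a) (y (suc j) b) → AdjHead k (y (suc j) b) l →
         Tail k j l → Tail k (suc j) (x (suc j) a ∷ y (suc j) b ∷ l)

Chain-∷ : ∀ {k v l} → AdjHead k v l → Chain k l → Chain k (v ∷ l)
Chain-∷ {l = _ ∷ _} vu chain = vu , chain

last-∷ : ∀ (v : V) l {u} → last l ≡ just u → last (v ∷ l) ≡ just u
last-∷ v (_ ∷ _) ends = ends

Tail-chain : ∀ {k j l} → Tail k j l → Chain k l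
Tail-chain tip = tt
Tail-chain (rung xy yl τ) = xy , Chain-∷ yl (Tail-chain τ)

Tail-last : ∀ {k j l} → Tail k j l → last l ≡ just t
Tail-last tip = refl
Tail-last (rung {j} {b = b} {l} _ _ τ) = last-∷ (y (suc j) b) l (Tail-last τ)

Tail-length : ∀ {k j l} → Tail k j l → length l ≡ suc (double j)
Tail-length tip = refl
Tail-length (rung _ _ τ) = cong (λ n → suc (suc n)) (Tail-length τ)

Tail-shortest : ∀ {k l} → Tail (suc k) (suc k) l → Shortest (suc k) (s ∷ l)
Tail-shortest τ@(rung xy _ _) with x-index xy
... | a≥1 , a≤7 = (Chain-∷ (inj₁ (sx (s≤s z≤n) a≥1 a≤7)) (Tail-chain τ) , refl , Tail-last τ)
                  , λ q walk → ≤-trans (≤-reflexive (cong suc (Tail-length τ))) (STWalk-length walk)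

Odd : ℕ → Set
Odd b = b ≡ 1 ⊎ b ≡ 3 ⊎ b ≡ 5

Odd-index : ∀ {b} → Odd b → 1 ≤ b × b ≤ 6
Odd-index (inj₁ refl) = s≤s z≤n , ≤ᵇ⇒≤ 1 6 _
Odd-index (inj₂ (inj₁ refl)) = s≤s z≤n , ≤ᵇ⇒≤ 3 6 _
Odd-index (inj₂ (inj₂ refl)) = s≤s z≤n , ≤ᵇ⇒≤ 5 6 _

y-odd↝Tail : ∀ {k j b l} → suc j ≤ k → Odd b → Tail k j l → AdjHead k (y (suc j) b) l
y-odd↝Tail sk odd tip with Odd-index odd
... | b≥1 , b≤6 = inj₁ (yt sk b≥1 b≤6)
y-odd↝Tail sk odd (rung xy _ _) with x-index xy
... | a≥1 , a≤7 = inj₁ (yx-odd (s≤s z≤n) sk odd a≥1 a≤7)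

-- pe k = s ∷ downₑ k for k ≥ 1, just as pb k = s ∷ down k.
downₑ : ℕ → List V
downₑ zero = t ∷ []
downₑ (suc j) = x (suc j) 7 ∷ y (suc j) 6 ∷ down j

y₂↝down : ∀ {k} j → suc j ≤ k → AdjHead k (y (suc j) 2) (down j)
y₂↝down zero sk = inj₁ (yt sk (s≤s z≤n) (≤ᵇ⇒≤ 2 6 _))
y₂↝down (suc j) sk = inj₁ (yx-2 (s≤s z≤n) sk)

y₆↝down : ∀ {k} j → suc j ≤ k → AdjHead k (y (suc j) 6) (down j)
y₆↝down zero sk = inj₁ (yt sk (s≤s z≤n) ≤-refl)
y₆↝down (suc j) sk = inj₁ (yx-6 (s≤s z≤n) sk)

y₄↝downₑ : ∀ {k} j → suc j ≤ k → AdjHead k (y (suc j) 4) (downₑ j)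
y₄↝downₑ zero sk = inj₁ (yt sk (s≤s z≤n) (≤ᵇ⇒≤ 4 6 _))
y₄↝downₑ (suc j) sk = inj₁ (yx-4 (s≤s z≤n) sk)

-- The hidden arguments reduce to ⊤, so they are filled in automatically when a is a literal.

x≈y : ∀ {k j} → suc j ≤ k → ∀ a {_ : T (1 ≤ᵇ a)} {_ : T (a ≤ᵇ 6)} → Adj k (x (suc j) a) (y (suc j) a)
x≈y sk a {a≥1} {a≤6} = inj₁ (xy-same (s≤s z≤n) sk (≤ᵇ⇒≤ 1 a a≥1) (≤ᵇ⇒≤ a 6 a≤6))

x⁺≈y : ∀ {k j} → suc j ≤ k → ∀ a {_ : T (1 ≤ᵇ a)} {_ : T (a ≤ᵇ 6)} → Adj k (x (suc j) (suc a)) (y (suc j) a)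
x⁺≈y sk a {a≥1} {a≤6} = inj₁ (xy-next (s≤s z≤n) sk (≤ᵇ⇒≤ 1 a a≥1) (≤ᵇ⇒≤ a 6 a≤6))

steps : ℕ → ℕ
steps zero = 0
steps (suc j) = 5 + (steps j + (3 + (steps j + 3)))

ladder-step : ∀ {k} j → suc j ≤ k → Walk (Tail k j) (steps j) (down j) (downₑ j) →
              Walk (Tail k (suc j)) (steps (suc j)) (down (suc j)) (downₑ (suc j))
ladder-step {k} j sk lower = climb ++ʷ beneath (x⁺≈y sk 3) odd₃ ++ʷ cross ++ʷ
                                  reverse (beneath (x≈y sk 5) odd₅) ++ʷ finish
  where
  J = suc j
  D = down j
  E = downₑ j
  τD = source lower
  τE = target lower
  odd₁ : Odd 1
  odd₁ = inj₁ refl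
  odd₃ : Odd 3
  odd₃ = inj₂ (inj₁ refl)
  odd₅ : Odd 5
  odd₅ = inj₂ (inj₂ refl)

  climb : Walk (Tail k J) 5 (down J) (x J 4 ∷ y J 3 ∷ D)
  climb = rung (x≈y sk 1) (y-odd↝Tail sk odd₁ τD) τD ∷⟨ here (λ ()) ⟩
          rung (x⁺≈y sk 1) (y-odd↝Tail sk odd₁ τD) τD ∷⟨ there (here (λ ())) ⟩
          rung (x≈y sk 2) (y₂↝down j sk) τD ∷⟨ here (λ ()) ⟩
          rung (x⁺≈y sk 2) (y₂↝down j sk) τD ∷⟨ there (here (λ ())) ⟩
          rung (x≈y sk 3) (y-odd↝Tail sk odd₃ τD) τD ∷⟨ here (λ ()) ⟩
          [ rung (x⁺≈y sk 3) (y-odd↝Tail sk odd₃ τD) τD ]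

  beneath : ∀ {a b} → Adj k (x J a) (y J b) → Odd b →
            Walk (Tail k J) (steps j) (x J a ∷ y J b ∷ D) (x J a ∷ y J b ∷ E)
  beneath {a} {b} xy odd = prepend (x J a ∷ y J b ∷ []) (λ τ → rung xy (y-odd↝Tail sk odd τ) τ) lower

  cross : Walk (Tail k J) 3 (x J 4 ∷ y J 3 ∷ E) (x J 5 ∷ y J 5 ∷ E)
  cross = rung (x⁺≈y sk 3) (y-odd↝Tail sk odd₃ τE) τE ∷⟨ there (here (λ ())) ⟩
          rung (x≈y sk 4) (y₄↝downₑ j sk) τE ∷⟨ here (λ ()) ⟩
          rung (x⁺≈y sk 4) (y₄↝downₑ j sk) τE ∷⟨ there (here (λ ())) ⟩
          [ rung (x≈y sk 5) (y-odd↝Tail sk odd₅ τE) τE ]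

  finish : Walk (Tail k J) 3 (x J 5 ∷ y J 5 ∷ D) (downₑ J)
  finish = rung (x≈y sk 5) (y-odd↝Tail sk odd₅ τD) τD ∷⟨ here (λ ()) ⟩
           rung (x⁺≈y sk 5) (y-odd↝Tail sk odd₅ τD) τD ∷⟨ there (here (λ ())) ⟩
           rung (x≈y sk 6) (y₆↝down j sk) τD ∷⟨ here (λ ()) ⟩
           [ rung (x⁺≈y sk 6) (y₆↝down j sk) τD ]

reconfigure : ∀ {k} j → j ≤ k → Walk (Tail k j) (steps j) (down j) (downₑ j)
reconfigure zero _ = [ tip ]
reconfigure (suc j) sk = ladder-step j sk (reconfigure j (≤-trans (n≤1+n j) sk))

steps+11 : ∀ j → steps j + 11 ≡ 11 * 2 ^ j
steps+11 zero = refl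
steps+11 (suc j) = begin
  5 + (steps j + (3 + (steps j + 3))) + 11 ≡⟨ regroup (steps j) ⟩
  (steps j + 11) + (steps j + 11)           ≡⟨ cong₂ _+_ (steps+11 j) (steps+11 j) ⟩
  11 * 2 ^ j + 11 * 2 ^ j                   ≡⟨ double-power (2 ^ j) ⟩
  11 * 2 ^ suc j                            ∎
  where
  open ≡-Reasoning
  regroup : ∀ n → 5 + (n + (3 + (n + 3))) + 11 ≡ (n + 11) + (n + 11)
  regroup = solve-∀
  double-power : ∀ m → 11 * m + 11 * m ≡ 11 * (2 * m)
  double-power = solve-∀

steps-closed : ∀ j → steps j ≡ 11 * (2 ^ j ∸ 1)
steps-closed j = begin
  steps j                ≡⟨ sym (m+n∸n≡m (steps j) 11) ⟩
  steps j + 11 ∸ 11      ≡⟨ cong (_∸ 11) (steps+11 j) ⟩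
  11 * 2 ^ j ∸ 11 * 1    ≡⟨ sym (*-distribˡ-∸ 11 (2 ^ j) 1) ⟩
  11 * (2 ^ j ∸ 1)       ∎
  where open ≡-Reasoning

lemma2 : ∀ (k : ℕ) → 1 ≤ k →
    ∃[ n ] (n ≤ 11 * (2 ^ k ∸ 1) × Reach k n (pb k) (pe k))
lemma2 (suc k) _ = steps (suc k) , ≤-reflexive (steps-closed (suc k)) ,
  Walk⇒Reach (prepend (s ∷ []) Tail-shortest (reconfigure (suc k) ≤-refl))
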